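{- Let $G_1,G_2$ be groups and let $G$ be a subgroup of $G_1\times G_2$ such that the projections $\pi_1:G\to G_1$ and $\pi_2:G\to G_2$ are surjective. Then $G$ is normal in $G_1\times G_2$ if and only if $G$ has abelian entanglements, i.e. if and only if the Goursat quotient $G_1/\pi_1\big(G\cap(G_1\times\{1\})\big)$ is abelian.
   Context: For $G\le G_1\times G_2$ with surjective projections, $N_1=G\cap(G_1\times\{1\})$; then $\pi_1(N_1)$ is normal in $G_1$ and the Goursat quotient $G_1/\pi_1(N_1)$ is isomorphic to $G_2/\pi_2(G\cap(\{1\}\times G_2))$. Having abelian entanglements means this quotient is abelian. -}

module Defs where

open import Level using (Level; _⊔_; suc)
open import Algebra.Bundles using (Group)
open import Data.Product using (_×_; _,_; proj₁; proj₂; ∃)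
import Algebra.Construct.DirectProduct as DP

private variable c ℓ c₁ ℓ₁ c₂ ℓ₂ p : Level

record IsSubgroup (H : Group c ℓ) (S : Group.Carrier H → Set p) : Set (c ⊔ ℓ ⊔ p) where
  open Group H
  field
    respects : ∀ {x y} → x ≈ y → S x → S y
    ε-closed : S ε
    ∙-closed : ∀ {x y} → S x → S y → S (x ∙ y)
    ⁻¹-closed : ∀ {x} → S x → S (x ⁻¹)

IsNormal : (H : Group c ℓ) → (Group.Carrier H → Set p) → Set (c ⊔ p)
IsNormal H S = ∀ g h → S h → S (g ∙ h ∙ g ⁻¹)
  where open Group H

_×ᴳ_ : Group c₁ ℓ₁ → Group c₂ ℓ₂ → Group (c₁ ⊔ c₂) (ℓ₁ ⊔ ℓ₂)
_×ᴳ_ = DP.group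

module _ (G₁ : Group c₁ ℓ₁) (G₂ : Group c₂ ℓ₂) where
  private
    module G₁ = Group G₁
    module G₂ = Group G₂

  Proj₁Surjective : (G₁.Carrier × G₂.Carrier → Set p) → Set (c₁ ⊔ c₂ ⊔ ℓ₁ ⊔ p)
  Proj₁Surjective S = ∀ a → ∃ λ x → S x × proj₁ x G₁.≈ a

  Proj₂Surjective : (G₁.Carrier × G₂.Carrier → Set p) → Set (c₁ ⊔ c₂ ⊔ ℓ₂ ⊔ p)
  Proj₂Surjective S = ∀ b → ∃ λ x → S x × proj₂ x G₂.≈ b

  π₁N₁ : (G₁.Carrier × G₂.Carrier → Set p) → G₁.Carrier → Set (c₁ ⊔ c₂ ⊔ ℓ₁ ⊔ ℓ₂ ⊔ p)
  π₁N₁ S a = ∃ λ x → (S x × proj₂ x G₂.≈ G₂.ε) × proj₁ x G₁.≈ a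

-- Equality in the quotient H / K (cosets K x = K y), on the carrier of H.
_≈[_/_]_ : {H : Group c ℓ} → Group.Carrier H → (K : Group.Carrier H → Set p) → Group.Carrier H → Set p
_≈[_/_]_ {H = H} x K y = K (x ∙ y ⁻¹)
  where open Group H

QuotientIsAbelian : (H : Group c ℓ) → (Group.Carrier H → Set p) → Set (c ⊔ p)
QuotientIsAbelian H K = ∀ a b → _≈[_/_]_ {H = H} (a ∙ b) K (b ∙ a)
  where open Group H

HasAbelianEntanglements : (G₁ : Group c₁ ℓ₁) (G₂ : Group c₂ ℓ₂) →
  (Group.Carrier G₁ × Group.Carrier G₂ → Set p) → Set (c₁ ⊔ c₂ ⊔ ℓ₁ ⊔ ℓ₂ ⊔ p)
HasAbelianEntanglements G₁ G₂ S = QuotientIsAbelian G₁ (π₁N₁ G₁ G₂ S)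

module Submission where

-- Let G ≤ G₁ × G₂ project onto both factors and let N = π₁(G ∩ (G₁ × {1})).
-- Write ι k = (k , 1) and [a , b] = (a b)(b a)⁻¹; "G has abelian entanglements"
-- says exactly that N contains every [a , b].  From  a b a⁻¹ = [a , b] b,
-- applied in the first coordinate, every x ∈ G₁ × G₂ satisfies
--     ι k · x · (ι k)⁻¹ = ι [k , x₁] · x .                             (∗)
-- Hence for x ∈ G the conjugate of x by ι k lies in G iff [k , x₁] ∈ N.
--  • Normal ⇒ abelian entanglements: lift b to y ∈ G; normality puts the
--    conjugate of y by ι a into G, so [a , b] = [a , y₁] ∈ N.
--  • Abelian entanglements ⇒ normal: lifting g₂ to u ∈ G factors an arbitrary
--    g as ι k · u, so conjugation by g is conjugation by u ∈ G (which keeps G)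
--    followed by conjugation by ι k (which keeps G by (∗)).

open import Defs
open import Level using (Level)
open import Algebra.Bundles using (Group)
open import Data.Product using (_×_; _,_; proj₁; proj₂)
open import Function.Bundles using (_⇔_; mk⇔)
import Algebra.Properties.Group as GroupProperties
import Relation.Binary.Reasoning.Setoid as SetoidReasoning

module GroupFacts {c ℓ : Level} (H : Group c ℓ) where
  open Group H
  open GroupProperties H using (⁻¹-anti-homo-∙; //-rightDividesˡ)
  open SetoidReasoning setoid

  -- The element whose membership in K expresses  a b ≡ b a  in H / K.
  commutator : Carrier → Carrier → Carrier
  commutator a b = (a ∙ b) ∙ (b ∙ a) ⁻¹

  commutator-congʳ : ∀ a {b b′} → b ≈ b′ → commutator a b ≈ commutator a b′
  commutator-congʳ a b≈b′ = ∙-cong (∙-congˡ b≈b′) (⁻¹-cong (∙-congʳ b≈b′))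

  conjugate≈commutator∙ : ∀ a b → a ∙ b ∙ a ⁻¹ ≈ commutator a b ∙ b
  conjugate≈commutator∙ a b = sym (begin
    (a ∙ b) ∙ (b ∙ a) ⁻¹ ∙ b        ≈⟨ ∙-congʳ (∙-congˡ (⁻¹-anti-homo-∙ b a)) ⟩
    (a ∙ b) ∙ (a ⁻¹ ∙ b ⁻¹) ∙ b     ≈⟨ assoc (a ∙ b) (a ⁻¹ ∙ b ⁻¹) b ⟩
    (a ∙ b) ∙ ((a ⁻¹ ∙ b ⁻¹) ∙ b)   ≈⟨ ∙-congˡ (//-rightDividesˡ b (a ⁻¹)) ⟩
    a ∙ b ∙ a ⁻¹                    ∎)

  conjugate-∙ : ∀ k u h → (k ∙ u) ∙ h ∙ (k ∙ u) ⁻¹ ≈ k ∙ (u ∙ h ∙ u ⁻¹) ∙ k ⁻¹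
  conjugate-∙ k u h = begin
    (k ∙ u) ∙ h ∙ (k ∙ u) ⁻¹      ≈⟨ ∙-congˡ (⁻¹-anti-homo-∙ k u) ⟩
    (k ∙ u) ∙ h ∙ (u ⁻¹ ∙ k ⁻¹)   ≈⟨ assoc ((k ∙ u) ∙ h) (u ⁻¹) (k ⁻¹) ⟨
    (k ∙ u) ∙ h ∙ u ⁻¹ ∙ k ⁻¹     ≈⟨ ∙-congʳ (∙-congʳ (assoc k u h)) ⟩
    k ∙ (u ∙ h) ∙ u ⁻¹ ∙ k ⁻¹     ≈⟨ ∙-congʳ (assoc k (u ∙ h) (u ⁻¹)) ⟩
    k ∙ (u ∙ h ∙ u ⁻¹) ∙ k ⁻¹     ∎

  conjugate-congˡ : ∀ {g g′} h → g ≈ g′ → g ∙ h ∙ g ⁻¹ ≈ g′ ∙ h ∙ g′ ⁻¹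
  conjugate-congˡ h g≈g′ = ∙-cong (∙-congʳ g≈g′) (⁻¹-cong g≈g′)

  conjugate-closed : ∀ {p} {S : Carrier → Set p} → IsSubgroup H S →
    ∀ {u h} → S u → S h → S (u ∙ h ∙ u ⁻¹)
  conjugate-closed sg Su Sh = ∙-closed (∙-closed Su Sh) (⁻¹-closed Su)
    where open IsSubgroup sg

module Goursat {c₁ ℓ₁ c₂ ℓ₂ p : Level} (G₁ : Group c₁ ℓ₁) (G₂ : Group c₂ ℓ₂)
  (G : Group.Carrier G₁ × Group.Carrier G₂ → Set p) (sg : IsSubgroup (G₁ ×ᴳ G₂) G) where

  private
    module A = Group G₁
    module B = Group G₂
    module P = Group (G₁ ×ᴳ G₂)
    module PA = GroupProperties G₁
    module PB = GroupProperties G₂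
    module PP = GroupProperties (G₁ ×ᴳ G₂)
  open GroupFacts G₁ using (commutator; commutator-congʳ; conjugate≈commutator∙)
  open GroupFacts (G₁ ×ᴳ G₂) using (conjugate-∙; conjugate-congˡ; conjugate-closed)
  open IsSubgroup sg

  N : A.Carrier → Set _
  N = π₁N₁ G₁ G₂ G

  ι : A.Carrier → P.Carrier
  ι k = k , B.ε

  N-respects : ∀ {a b} → a A.≈ b → N a → N b
  N-respects a≈b (x , inG , x₁≈a) = x , inG , A.trans x₁≈a a≈b

  ι-member⇒N : ∀ {w k} → G w → w P.≈ ι k → N k
  ι-member⇒N Gw (w₁≈k , w₂≈ε) = _ , (Gw , w₂≈ε) , w₁≈k

  N⇒ι-member : ∀ {k} → N k → G (ι k)
  N⇒ι-member (x , (Gx , x₂≈ε) , x₁≈k) = respects (x₁≈k , x₂≈ε) Gx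

  conjugate-by-ι : ∀ k x → ι k P.∙ x P.∙ ι k P.⁻¹ P.≈ ι (commutator k (proj₁ x)) P.∙ x
  conjugate-by-ι k (x₁ , x₂) = conjugate≈commutator∙ k x₁ , ε-conjugate
    where
      ε-conjugate : B.ε B.∙ x₂ B.∙ B.ε B.⁻¹ B.≈ B.ε B.∙ x₂
      ε-conjugate = B.trans (B.∙-congˡ PB.ε⁻¹≈ε) (B.identityʳ (B.ε B.∙ x₂))

  conjugate-by-ι⇒commutator∈N : ∀ k {x} → G x →
    G (ι k P.∙ x P.∙ ι k P.⁻¹) → N (commutator k (proj₁ x))
  conjugate-by-ι⇒commutator∈N k {x} Gx Gconj =
    ι-member⇒N (∙-closed Gconj (⁻¹-closed Gx))
      (P.sym (PP.x≈z//y _ x _ (P.sym (conjugate-by-ι k x))))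

  commutator∈N⇒conjugate-by-ι : ∀ k {x} → G x →
    N (commutator k (proj₁ x)) → G (ι k P.∙ x P.∙ ι k P.⁻¹)
  commutator∈N⇒conjugate-by-ι k {x} Gx n =
    respects (P.sym (conjugate-by-ι k x)) (∙-closed (N⇒ι-member n) Gx)

  ι-factorisation : ∀ g u → proj₂ u B.≈ proj₂ g → g P.≈ ι (proj₁ g A.// proj₁ u) P.∙ u
  ι-factorisation (g₁ , g₂) (u₁ , u₂) u₂≈g₂ =
    A.sym (PA.//-rightDividesˡ u₁ g₁) , B.sym (B.trans (B.identityˡ u₂) u₂≈g₂)

  normal⇒abelianEntanglements : Proj₁Surjective G₁ G₂ G →
    IsNormal (G₁ ×ᴳ G₂) G → HasAbelianEntanglements G₁ G₂ G
  normal⇒abelianEntanglements lift₁ normal a b =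
    let (y , Gy , y₁≈b) = lift₁ b
    in N-respects (commutator-congʳ a y₁≈b)
         (conjugate-by-ι⇒commutator∈N a Gy (normal (ι a) y Gy))

  abelianEntanglements⇒normal : Proj₂Surjective G₁ G₂ G →
    HasAbelianEntanglements G₁ G₂ G → IsNormal (G₁ ×ᴳ G₂) G
  abelianEntanglements⇒normal lift₂ abelian g h Gh =
    let (u , Gu , u₂≈g₂) = lift₂ (proj₂ g)
        k = proj₁ g A.// proj₁ u
        uhu⁻¹ = u P.∙ h P.∙ u P.⁻¹
        g≈ιk∙u = ι-factorisation g u u₂≈g₂
    in respects
         (P.sym (P.trans (conjugate-congˡ h g≈ιk∙u) (conjugate-∙ (ι k) u h)))
         (commutator∈N⇒conjugate-by-ι k (conjugate-closed sg Gu Gh)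
           (abelian k (proj₁ uhu⁻¹)))

proposition2p4 : {c₁ ℓ₁ c₂ ℓ₂ p : Level} (G₁ : Group c₁ ℓ₁) (G₂ : Group c₂ ℓ₂)
    (G : Group.Carrier G₁ × Group.Carrier G₂ → Set p) →
    IsSubgroup (G₁ ×ᴳ G₂) G →
    Proj₁Surjective G₁ G₂ G →
    Proj₂Surjective G₁ G₂ G →
    IsNormal (G₁ ×ᴳ G₂) G ⇔ HasAbelianEntanglements G₁ G₂ G
proposition2p4 G₁ G₂ G sg lift₁ lift₂ =
  mk⇔ (normal⇒abelianEntanglements lift₁) (abelianEntanglements⇒normal lift₂)
  where open Goursat G₁ G₂ G sg
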